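{- For every $n\ge2$ and every $\sigma\in D_n$, $sor_D(\sigma)=sor_D'(\sigma)$.
   Context: $B_n$ is the group of bijections $\sigma$ of $\{\pm1,\ldots,\pm n\}$ with $\sigma(-i)=-\sigma(i)$, with composition as product; $D_n$ is the subgroup of elements with an even number of negative values among $\sigma(1),\ldots,\sigma(n)$. Reflections: for $1\le i<j\le n$, $(i,j)$ exchanges $i,j$ and $-i,-j$; $(-i,j)$ exchanges $-i,j$ and $i,-j$; for $1\le j\le n$, $(-j,j)$ exchanges $j,-j$. $T^B$ is the set of these. Every $\sigma\in D_n$ factors uniquely as $(i_1,j_1)\cdots(i_k,j_k)$ with factors in $T^B$, $0<j_1<\cdots<j_k\le n$, and $sor_D(\sigma)=\sum_r(j_r-i_r-2\chi(i_r<0))$, $\chi$ the indicator. Let $t_{ij}=(i,j)$ for $1\le|i|<j\le n$, $t_{ -i,i}=(-i,i)(-1,1)$ for $1<i\le n$, $T^D=\{t_{ij}:1\le|i|<j\le n\}\cup\{t_{ -i,i}:1<i\le n\}$. Every $\sigma\in D_n$ can be written uniquely as $\sigma=t_{i_1j_1}t_{i_2j_2}\cdots t_{i_mj_m}$ with factors in $T^D$ and $1<j_1<\cdots<j_m\le n$; the co-sorting index is $sor_D'(\sigma)=\sum_{r=1}^m(j_r-i_r-2\chi(i_r<0))$. -}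

module Defs where

open import Data.Bool using (if_then_else_)
open import Data.Nat as ℕ using (ℕ; suc; _≤_; _<_)
open import Data.Integer as ℤ using (ℤ; +_; -_; ∣_∣; 0ℤ)
open import Data.List using (List; []; _∷_; map; filter; length; upTo)
open import Data.List.Relation.Unary.All using (All)
open import Data.List.Relation.Unary.Linked using (Linked)
open import Data.Product using (_×_; _,_; proj₁; proj₂; ∃)
open import Data.Sum using (_⊎_)
open import Relation.Nullary using (does)
open import Relation.Binary.PropositionalEquality using (_≡_)

-- Signed permutations of {±1,…,±n} are represented by functions ℤ → ℤ;
-- only their values on {±1,…,±n} matter.

[1‥_] : ℕ → List ℕ
[1‥ n ] = map suc (upTo n)

IsSignedPerm : ℕ → (ℤ → ℤ) → Set
IsSignedPerm n σ =
  (∀ x → σ (- x) ≡ - σ x) ×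
  (∀ x → 1 ≤ ∣ x ∣ → ∣ x ∣ ≤ n → (1 ≤ ∣ σ x ∣) × (∣ σ x ∣ ≤ n)) ×
  (∀ x y → 1 ≤ ∣ x ∣ → ∣ x ∣ ≤ n → 1 ≤ ∣ y ∣ → ∣ y ∣ ≤ n → σ x ≡ σ y → x ≡ y)

Even : ℕ → Set
Even m = ∃ λ k → m ≡ 2 ℕ.* k

negCount : ℕ → (ℤ → ℤ) → ℕ
negCount n σ = length (filter (λ x → σ (+ x) ℤ.<? 0ℤ) [1‥ n ])

InD : ℕ → (ℤ → ℤ) → Set
InD n σ = IsSignedPerm n σ × Even (negCount n σ)

refl : ℤ → ℤ → ℤ → ℤ
refl a b x =
  if does (x ℤ.≟ a) then b else
  if does (x ℤ.≟ b) then a else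
  if does (x ℤ.≟ - a) then - b else
  if does (x ℤ.≟ - b) then - a else x

Factor : Set
Factor = ℤ × ℕ

ValidB : ℕ → Factor → Set
ValidB n (i , j) =
  ((1 ≤ ∣ i ∣) × (∣ i ∣ < j) × (j ≤ n)) ⊎ ((i ≡ - (+ j)) × (1 ≤ j) × (j ≤ n))

ValidD : ℕ → Factor → Set
ValidD n (i , j) =
  ((1 ≤ ∣ i ∣) × (∣ i ∣ < j) × (j ≤ n)) ⊎ ((i ≡ - (+ j)) × (1 < j) × (j ≤ n))

toB : Factor → ℤ → ℤ
toB (i , j) = refl i (+ j)

toD : Factor → ℤ → ℤ
toD (i , j) x =
  if does (i ℤ.≟ - (+ j)) then refl i (+ j) (refl (- (+ 1)) (+ 1) x)
  else refl i (+ j) x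

prod : List (ℤ → ℤ) → ℤ → ℤ
prod [] x = x
prod (t ∷ ts) x = t (prod ts x)

-- σ = product, checked on 1,…,n (determines σ on ±1,…,±n by oddness)
Represents : ℕ → (ℤ → ℤ) → List (ℤ → ℤ) → Set
Represents n σ ts = All (λ x → σ (+ x) ≡ prod ts (+ x)) [1‥ n ]

BFactorization : ℕ → (ℤ → ℤ) → List Factor → Set
BFactorization n σ fs =
  All (ValidB n) fs × Linked _<_ (map proj₂ fs) × Represents n σ (map toB fs)

DFactorization : ℕ → (ℤ → ℤ) → List Factor → Set
DFactorization n σ fs =
  All (ValidD n) fs × Linked _<_ (map proj₂ fs) × Represents n σ (map toD fs)

χneg : ℤ → ℤ
χneg i = if does (i ℤ.<? 0ℤ) then + 1 else 0ℤ

sorSum : List Factor → ℤ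
sorSum [] = 0ℤ
sorSum ((i , j) ∷ fs) = ((+ j) ℤ.- i ℤ.- (+ 2) ℤ.* χneg i) ℤ.+ sorSum fs

module Submission where

-- The rightmost factor (i,j) of either factorization carries the largest index j, and the factors
-- to its left fix every x with |x| ≥ j. Hence j is the largest x ≥ 2 moved by σ, and the product
-- sends i to j; as products are injective, the rightmost factors of the two factorizations share j,
-- and also i unless |i| = 1, where both weights are j - 1. Cancelling them (t_{-j,j} agrees with
-- (-j,j) off ±1) leaves two factorizations agreeing off ±1, and induction finishes.

open import Defs renaming (refl to reflect)
open import Data.Integer as ℤ using (ℤ; +_; -[1+_]; -_; ∣_∣; 0ℤ)
import Data.Integer.Properties as ℤP
open import Data.List using (List; []; _∷_; map; reverse; _++_; _∷ʳ_)
import Data.List.Properties as ListP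
open import Data.List.Relation.Unary.All as All using (All; []; _∷_)
import Data.List.Relation.Unary.All.Properties as AllP
import Data.List.Relation.Unary.Any.Properties as AnyP
open import Data.List.Relation.Unary.AllPairs using (AllPairs; []; _∷_)
import Data.List.Relation.Unary.AllPairs.Properties as AllPairsP
open import Data.List.Relation.Unary.Linked using (Linked)
import Data.List.Relation.Unary.Linked.Properties as LinkedP
open import Data.Nat as ℕ using (ℕ; suc; _≤_; _<_; _>_; s≤s)
import Data.Nat.Properties as ℕP
open import Data.Product using (_×_; _,_; proj₁; proj₂)
open import Data.Sum using (_⊎_; inj₁; inj₂)
open import Function using (_∘_; id; flip; _on_)
open import Relation.Binary using (tri<; tri≈; tri>)
open import Relation.Nullary using (yes; no; contradiction)
open import Relation.Binary.PropositionalEquality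
open ≡-Reasoning

∣-+j∣ : ∀ j → ∣ - + j ∣ ≡ j
∣-+j∣ j = ℤP.∣-i∣≡∣i∣ (+ j)

neg-flip : ∀ {x y : ℤ} → - x ≡ y → x ≡ - y
neg-flip {x} e = trans (sym (ℤP.neg-involutive x)) (cong -_ e)

neg-≢-self : ∀ {x} → x ≢ 0ℤ → - x ≢ x
neg-≢-self {+ 0} x≢0 _ = x≢0 refl
neg-≢-self {+ suc _} _ ()
neg-≢-self { -[1+ _ ]} _ ()

2≤⇒≢1 : ∀ {k} → 2 ≤ k → k ≢ 1
2≤⇒≢1 2≤k k≡1 = ℕP.<-irrefl (sym k≡1) 2≤k

unit-or-≥2 : ∀ {k} → 1 ≤ k → k ≡ 1 ⊎ 2 ≤ k
unit-or-≥2 1≤k with ℕP.m≤n⇒m<n∨m≡n 1≤k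
... | inj₁ 1<k = inj₂ 1<k
... | inj₂ 1≡k = inj₁ (sym 1≡k)

ReflectionPair : ℤ → ℤ → Set
ReflectionPair a b = a ≢ 0ℤ × b ≢ 0ℤ × a ≢ b

module _ {a b : ℤ} where

  reflect-elim : ∀ {x} (P : ℤ → Set) →
    (x ≡ a → P b) →
    (x ≢ a → x ≡ b → P a) →
    (x ≢ a → x ≢ b → x ≡ - a → P (- b)) →
    (x ≢ a → x ≢ b → x ≢ - a → x ≡ - b → P (- a)) →
    (x ≢ a → x ≢ b → x ≢ - a → x ≢ - b → P x) →
    P (reflect a b x)
  reflect-elim {x} P at-a at-b at-−a at-−b elsewhere
    with x ℤ.≟ a | x ℤ.≟ b | x ℤ.≟ - a | x ℤ.≟ - b
  ... | yes p | _     | _     | _     = at-a p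
  ... | no p  | yes q | _     | _     = at-b p q
  ... | no p  | no q  | yes r | _     = at-−a p q r
  ... | no p  | no q  | no r  | yes s = at-−b p q r s
  ... | no p  | no q  | no r  | no s  = elsewhere p q r s

  reflect-at-a : reflect a b a ≡ b
  reflect-at-a with a ℤ.≟ a
  ... | yes _   = refl
  ... | no a≢a = contradiction refl a≢a

  reflect-at-b : a ≢ b → reflect a b b ≡ a
  reflect-at-b a≢b with b ℤ.≟ a
  ... | yes b≡a = contradiction (sym b≡a) a≢b
  ... | no _ with b ℤ.≟ b
  ...   | yes _   = refl
  ...   | no b≢b = contradiction refl b≢b

  reflect-at-−a : a ≢ 0ℤ → reflect a b (- a) ≡ - b
  reflect-at-−a a≢0 with (- a) ℤ.≟ a
  ... | yes -a≡a = contradiction -a≡a (neg-≢-self a≢0)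
  ... | no _ with (- a) ℤ.≟ b
  ...   | yes -a≡b = neg-flip -a≡b
  ...   | no _ with (- a) ℤ.≟ (- a)
  ...     | yes _     = refl
  ...     | no -a≢-a = contradiction refl -a≢-a

  reflect-at-−b : b ≢ 0ℤ → a ≢ b → reflect a b (- b) ≡ - a
  reflect-at-−b b≢0 a≢b with (- b) ℤ.≟ a
  ... | yes -b≡a = neg-flip -b≡a
  ... | no _ with (- b) ℤ.≟ b
  ...   | yes -b≡b = contradiction -b≡b (neg-≢-self b≢0)
  ...   | no _ with (- b) ℤ.≟ (- a)
  ...     | yes -b≡-a = contradiction (sym (ℤP.neg-injective -b≡-a)) a≢b
  ...     | no _ with (- b) ℤ.≟ (- b)
  ...       | yes _     = refl
  ...       | no -b≢-b = contradiction refl -b≢-b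

  reflect-fixes′ : ∀ {x} → x ≢ a → x ≢ b → x ≢ - a → x ≢ - b → reflect a b x ≡ x
  reflect-fixes′ {x} x≢a x≢b x≢-a x≢-b = reflect-elim {x} (_≡ x)
    (λ x≡a → contradiction x≡a x≢a)
    (λ _ x≡b → contradiction x≡b x≢b)
    (λ _ _ x≡-a → contradiction x≡-a x≢-a)
    (λ _ _ _ x≡-b → contradiction x≡-b x≢-b)
    (λ _ _ _ _ → refl)

  reflect-fixes : ∀ {x} → ∣ x ∣ ≢ ∣ a ∣ → ∣ x ∣ ≢ ∣ b ∣ → reflect a b x ≡ x
  reflect-fixes x≉a x≉b = reflect-fixes′
    (x≉a ∘ cong ∣_∣) (x≉b ∘ cong ∣_∣)
    (λ x≡-a → x≉a (trans (cong ∣_∣ x≡-a) (ℤP.∣-i∣≡∣i∣ a)))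
    (λ x≡-b → x≉b (trans (cong ∣_∣ x≡-b) (ℤP.∣-i∣≡∣i∣ b)))

  reflect-involutive : ReflectionPair a b → ∀ x → reflect a b (reflect a b x) ≡ x
  reflect-involutive (a≢0 , b≢0 , a≢b) x = reflect-elim {x} (λ y → reflect a b y ≡ x)
    (λ x≡a → trans (reflect-at-b a≢b) (sym x≡a))
    (λ _ x≡b → trans reflect-at-a (sym x≡b))
    (λ _ _ x≡-a → trans (reflect-at-−b b≢0 a≢b) (sym x≡-a))
    (λ _ _ _ x≡-b → trans (reflect-at-−a a≢0) (sym x≡-b))
    reflect-fixes′

  reflect-odd : ReflectionPair a b → ∀ x → reflect a b (- x) ≡ - reflect a b x
  reflect-odd (a≢0 , b≢0 , a≢b) x = reflect-elim {x} (λ y → reflect a b (- x) ≡ - y)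
    (λ x≡a → trans (cong (reflect a b ∘ -_) x≡a) (reflect-at-−a a≢0))
    (λ _ x≡b → trans (cong (reflect a b ∘ -_) x≡b) (reflect-at-−b b≢0 a≢b))
    (λ _ _ x≡-a → trans (cong (reflect a b) (sym (neg-flip (sym x≡-a)))) (trans reflect-at-a (sym (ℤP.neg-involutive b))))
    (λ _ _ _ x≡-b → trans (cong (reflect a b) (sym (neg-flip (sym x≡-b)))) (trans (reflect-at-b a≢b) (sym (ℤP.neg-involutive a))))
    (λ x≢a x≢b x≢-a x≢-b → reflect-fixes′
      (x≢-a ∘ neg-flip) (x≢-b ∘ neg-flip) (x≢a ∘ ℤP.neg-injective) (x≢b ∘ ℤP.neg-injective))

  reflect-preserves-∣∣ : ∀ {x} (P : ℕ → Set) → P ∣ a ∣ → P ∣ b ∣ → P ∣ x ∣ → P ∣ reflect a b x ∣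
  reflect-preserves-∣∣ {x} P Pa Pb Px = reflect-elim {x} (P ∘ ∣_∣)
    (λ _ → Pb)
    (λ _ _ → Pa)
    (λ _ _ _ → subst P (sym (ℤP.∣-i∣≡∣i∣ b)) Pb)
    (λ _ _ _ _ → subst P (sym (ℤP.∣-i∣≡∣i∣ a)) Pa)
    (λ _ _ _ _ → Px)

Odd : (ℤ → ℤ) → Set
Odd f = ∀ x → f (- x) ≡ - f x

record SupportedBelow (m : ℕ) (f : ℤ → ℤ) : Set where
  field
    odd       : Odd f
    injective : ∀ {x y} → f x ≡ f y → x ≡ y
    fixes     : ∀ x → m ≤ ∣ x ∣ → f x ≡ x
    bounded   : ∀ x → ∣ x ∣ < m → ∣ f x ∣ < m

supportedBelow-id : ∀ {m} → SupportedBelow m id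
supportedBelow-id = record
  { odd = λ _ → refl ; injective = id ; fixes = λ _ _ → refl ; bounded = λ _ → id }

supportedBelow-∘ : ∀ {m f g} → SupportedBelow m f → SupportedBelow m g → SupportedBelow m (f ∘ g)
supportedBelow-∘ {f = f} {g} F G = record
  { odd       = λ x → trans (cong f (G.odd x)) (F.odd (g x))
  ; injective = G.injective ∘ F.injective
  ; fixes     = λ x m≤x → trans (cong f (G.fixes x m≤x)) (F.fixes x m≤x)
  ; bounded   = λ x x<m → F.bounded (g x) (G.bounded x x<m)
  }
  where
  module F = SupportedBelow F
  module G = SupportedBelow G

reflect-supportedBelow : ∀ {m a b} → ReflectionPair a b → ∣ a ∣ < m → ∣ b ∣ < m →
  SupportedBelow m (reflect a b)
reflect-supportedBelow {m} {a} {b} pair a<m b<m = record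
  { odd       = reflect-odd pair
  ; injective = λ {x} {y} e → begin
      x                           ≡⟨ reflect-involutive pair x ⟨
      reflect a b (reflect a b x) ≡⟨ cong (reflect a b) e ⟩
      reflect a b (reflect a b y) ≡⟨ reflect-involutive pair y ⟩
      y                           ∎
  ; fixes     = λ x m≤x → reflect-fixes {x = x} (below⇒≢ a<m m≤x) (below⇒≢ b<m m≤x)
  ; bounded   = λ x x<m → reflect-preserves-∣∣ {x = x} (_< m) a<m b<m x<m
  }
  where
  below⇒≢ : ∀ {c k} → c < m → m ≤ k → k ≢ c
  below⇒≢ c<m m≤k k≡c = ℕP.<⇒≱ c<m (subst (m ≤_) k≡c m≤k)

supportedBelow-misses-top : ∀ {m g y} → SupportedBelow m g → 1 ≤ m →
  ∣ y ∣ < m ⊎ y ≡ - + m → g y ≢ + m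
supportedBelow-misses-top G _ (inj₁ y<m) gy≡m =
  ℕP.<-irrefl (cong ∣_∣ gy≡m) (SupportedBelow.bounded G _ y<m)
supportedBelow-misses-top {m} G 1≤m (inj₂ refl) gy≡m =
  neg-≢-self m≢0 (trans (sym (SupportedBelow.fixes G (- + m) (ℕP.≤-reflexive (sym (∣-+j∣ m))))) gy≡m)
  where
  m≢0 : + m ≢ 0ℤ
  m≢0 m≡0 = ℕP.<-irrefl refl (subst (1 ≤_) (cong ∣_∣ m≡0) 1≤m)

module _ {n : ℕ} {i : ℤ} {j : ℕ} where

  validB-lower : ValidB n (i , j) → ∣ i ∣ < j ⊎ i ≡ - + j
  validB-lower (inj₁ (_ , i<j , _)) = inj₁ i<j
  validB-lower (inj₂ (i≡-j , _))    = inj₂ i≡-j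

  validB-1≤∣i∣ : ValidB n (i , j) → 1 ≤ ∣ i ∣
  validB-1≤∣i∣ (inj₁ (1≤i , _))       = 1≤i
  validB-1≤∣i∣ (inj₂ (refl , 1≤j , _)) = subst (1 ≤_) (sym (∣-+j∣ j)) 1≤j

  validB-j≤n : ValidB n (i , j) → j ≤ n
  validB-j≤n (inj₁ (_ , _ , j≤n)) = j≤n
  validB-j≤n (inj₂ (_ , _ , j≤n)) = j≤n

  validB-∣i∣≤j : ValidB n (i , j) → ∣ i ∣ ≤ j
  validB-∣i∣≤j v with validB-lower v
  ... | inj₁ i<j  = ℕP.<⇒≤ i<j
  ... | inj₂ refl = ℕP.≤-reflexive (∣-+j∣ j)

  validB-1≤j : ValidB n (i , j) → 1 ≤ j
  validB-1≤j v = ℕP.≤-trans (validB-1≤∣i∣ v) (validB-∣i∣≤j v)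

  validB-pair : ValidB n (i , j) → ReflectionPair i (+ j)
  validB-pair v = i≢0 , j≢0 , i≢j (validB-lower v)
    where
    i≢0 : i ≢ 0ℤ
    i≢0 i≡0 = ℕP.<-irrefl refl (subst (λ k → 1 ≤ ∣ k ∣) i≡0 (validB-1≤∣i∣ v))
    j≢0 : + j ≢ 0ℤ
    j≢0 j≡0 = ℕP.<-irrefl refl (subst (1 ≤_) (cong ∣_∣ j≡0) (validB-1≤j v))
    i≢j : ∣ i ∣ < j ⊎ i ≡ - + j → i ≢ + j
    i≢j (inj₁ i<j)  i≡j = ℕP.<-irrefl (cong ∣_∣ i≡j) i<j
    i≢j (inj₂ refl) i≡j = neg-≢-self j≢0 i≡j

  validD⇒validB : ValidD n (i , j) → ValidB n (i , j)
  validD⇒validB (inj₁ v)                 = inj₁ v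
  validD⇒validB (inj₂ (i≡-j , 1<j , j≤n)) = inj₂ (i≡-j , ℕP.<⇒≤ 1<j , j≤n)

  validD-2≤j : ValidD n (i , j) → 2 ≤ j
  validD-2≤j (inj₁ (1≤i , i<j , _)) = ℕP.≤-<-trans 1≤i i<j
  validD-2≤j (inj₂ (_ , 1<j , _))   = 1<j

module _ {i : ℤ} {j : ℕ} where

  toD≡toB : ∀ {x} → i ≢ - + j ⊎ 2 ≤ ∣ x ∣ → toD (i , j) x ≡ toB (i , j) x
  toD≡toB {x} h with i ℤ.≟ - (+ j) | h
  ... | no _     | _          = refl
  ... | yes i≡-j | inj₁ i≢-j  = contradiction i≡-j i≢-j
  ... | yes _    | inj₂ 2≤∣x∣ = cong (reflect i (+ j)) (reflect-fixes {x = x} x≢1 x≢1)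
    where
    x≢1 : ∣ x ∣ ≢ 1
    x≢1 = 2≤⇒≢1 2≤∣x∣

  module _ {n : ℕ} where

    toB-supportedBelow : ∀ {m} → ValidB n (i , j) → j < m → SupportedBelow m (toB (i , j))
    toB-supportedBelow v j<m =
      reflect-supportedBelow (validB-pair v) (ℕP.≤-<-trans (validB-∣i∣≤j v) j<m) j<m

    toD-supportedBelow : ∀ {m} → ValidD n (i , j) → j < m → SupportedBelow m (toD (i , j))
    toD-supportedBelow {m} v j<m with i ℤ.≟ - (+ j)
    ... | no _  = toB-supportedBelow (validD⇒validB v) j<m
    ... | yes _ = supportedBelow-∘ (toB-supportedBelow (validD⇒validB v) j<m)
                    (reflect-supportedBelow ((λ ()) , (λ ()) , (λ ())) 1<m 1<m)
      where
      1<m : 1 < m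
      1<m = ℕP.<-trans (validD-2≤j v) j<m

    toB-at-j : ValidB n (i , j) → toB (i , j) (+ j) ≡ i
    toB-at-j v = reflect-at-b (proj₂ (proj₂ (validB-pair v)))

    toD-at-j : ValidD n (i , j) → toD (i , j) (+ j) ≡ i
    toD-at-j v = trans (toD≡toB {x = + j} (inj₂ (validD-2≤j v))) (toB-at-j (validD⇒validB v))

    toD-at-i : ValidD n (i , j) → toD (i , j) i ≡ + j
    toD-at-i v = trans (toD≡toB {x = i} (off-±1 v)) (reflect-at-a {a = i})
      where
      off-±1 : ValidD n (i , j) → i ≢ - + j ⊎ 2 ≤ ∣ i ∣
      off-±1 (inj₁ (_ , i<j , _))  = inj₁ λ i≡-j → ℕP.<-irrefl (trans (cong ∣_∣ i≡-j) (∣-+j∣ j)) i<j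
      off-±1 (inj₂ (refl , 1<j , _)) = inj₂ (subst (2 ≤_) (sym (∣-+j∣ j)) 1<j)

-- t₁ t₂ ⋯ t_k applied left to right, i.e. the product t_k ⋯ t₂ t₁.
prodʳ : List (ℤ → ℤ) → ℤ → ℤ
prodʳ []       x = x
prodʳ (t ∷ ts) x = prodʳ ts (t x)

prodB prodD : List Factor → ℤ → ℤ
prodB rs = prodʳ (map toB rs)
prodD qs = prodʳ (map toD qs)

IndicesBelow : ℕ → List Factor → Set
IndicesBelow m = All ((_< m) ∘ proj₂)

Descending : List Factor → Set
Descending = AllPairs (_>_ on proj₂)

IndicesBelow-∷ : ∀ {i j m rs} → j < m → IndicesBelow j rs → IndicesBelow m ((i , j) ∷ rs)
IndicesBelow-∷ j<m rs<j = j<m ∷ All.map (λ k<j → ℕP.<-trans k<j j<m) rs<j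

module _ {n m : ℕ} where

  prodB-supportedBelow : ∀ {rs} → All (ValidB n) rs → IndicesBelow m rs → SupportedBelow m (prodB rs)
  prodB-supportedBelow []       []           = supportedBelow-id
  prodB-supportedBelow (v ∷ vs) (j<m ∷ rs<m) =
    supportedBelow-∘ (prodB-supportedBelow vs rs<m) (toB-supportedBelow v j<m)

  prodD-supportedBelow : ∀ {qs} → All (ValidD n) qs → IndicesBelow m qs → SupportedBelow m (prodD qs)
  prodD-supportedBelow []       []           = supportedBelow-id
  prodD-supportedBelow (v ∷ vs) (j<m ∷ qs<m) =
    supportedBelow-∘ (prodD-supportedBelow vs qs<m) (toD-supportedBelow v j<m)

module _ {n : ℕ} where

  prodB-supportedBelow-1+n : ∀ {rs} → All (ValidB n) rs → SupportedBelow (suc n) (prodB rs)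
  prodB-supportedBelow-1+n vs = prodB-supportedBelow vs (All.map (s≤s ∘ validB-j≤n) vs)

  prodD-supportedBelow-1+n : ∀ {qs} → All (ValidD n) qs → SupportedBelow (suc n) (prodD qs)
  prodD-supportedBelow-1+n vs = prodD-supportedBelow vs (All.map (s≤s ∘ validB-j≤n ∘ validD⇒validB) vs)

  toB-moves-top : ∀ {i j f} → ValidB n (i , j) → SupportedBelow j f → f (toB (i , j) (+ j)) ≢ + j
  toB-moves-top {i} {j} {f} v F = subst (λ y → f y ≢ + j) (sym (toB-at-j v))
    (supportedBelow-misses-top F (validB-1≤j v) (validB-lower v))

  toD-moves-top : ∀ {i j f} → ValidD n (i , j) → SupportedBelow j f → f (toD (i , j) (+ j)) ≢ + j
  toD-moves-top {i} {j} {f} v F = subst (λ y → f y ≢ + j) (sym (toD-at-j v))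
    (supportedBelow-misses-top F (validB-1≤j (validD⇒validB v)) (validB-lower (validD⇒validB v)))

-- Agreement is tracked only away from ±1: a B-factorization may end in the factor (-1,1),
-- which no D-factorization contains and whose weight is 0.
Agree : ℕ → (ℤ → ℤ) → (ℤ → ℤ) → Set
Agree n f g = ∀ x → 2 ≤ x → x ≤ n → f (+ x) ≡ g (+ x)

agree-signed : ∀ {n f g} → Odd f → Odd g → Agree n f g → ∀ y → 2 ≤ ∣ y ∣ → ∣ y ∣ ≤ n → f y ≡ g y
agree-signed _ _ agree (+ k) = agree k
agree-signed {f = f} {g} odd-f odd-g agree -[1+ k ] 2≤y y≤n = begin
  f -[1+ k ]      ≡⟨ odd-f (+ suc k) ⟩
  - f (+ suc k)   ≡⟨ cong -_ (agree (suc k) 2≤y y≤n) ⟩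
  - g (+ suc k)   ≡⟨ odd-g (+ suc k) ⟨
  g -[1+ k ]      ∎

module _ {n : ℕ} {f g : ℤ → ℤ} where

  agree-peel : ∀ {i j} → ValidB n (i , j) → 2 ≤ ∣ i ∣ → 2 ≤ j →
    Odd (f ∘ toB (i , j)) → Odd (g ∘ toD (i , j)) →
    Agree n (f ∘ toB (i , j)) (g ∘ toD (i , j)) → Agree n f g
  agree-peel {i} {j} v 2≤i 2≤j odd-f odd-g agree x 2≤x x≤n = begin
    f (+ x)            ≡⟨ cong f (reflect-involutive pair (+ x)) ⟨
    f (toB (i , j) y)  ≡⟨ agree-signed odd-f odd-g agree y (proj₁ y-in-range) (proj₂ y-in-range) ⟩
    g (toD (i , j) y)  ≡⟨ cong g (toD≡toB {i} {j} {y} (inj₂ (proj₁ y-in-range))) ⟩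
    g (toB (i , j) y)  ≡⟨ cong g (reflect-involutive pair (+ x)) ⟩
    g (+ x)            ∎
    where
    pair : ReflectionPair i (+ j)
    pair = validB-pair v
    y : ℤ
    y = toB (i , j) (+ x)
    InRange : ℕ → Set
    InRange k = 2 ≤ k × k ≤ n
    y-in-range : InRange ∣ y ∣
    y-in-range = reflect-preserves-∣∣ {i} {+ j} {+ x} InRange
      (2≤i , ℕP.≤-trans (validB-∣i∣≤j v) (validB-j≤n v)) (2≤j , validB-j≤n v) (2≤x , x≤n)

  agree-peel-unit : ∀ {i i' j} → ∣ i ∣ ≡ 1 → ∣ i' ∣ ≡ 1 → SupportedBelow j f → SupportedBelow j g →
    Agree n (f ∘ toB (i , j)) (g ∘ toD (i' , j)) → Agree n f g
  agree-peel-unit {i} {i'} {j} ∣i∣≡1 ∣i'∣≡1 F G agree x 2≤x x≤n with x ℕ.≟ j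
  ... | yes refl = trans (SupportedBelow.fixes F (+ x) ℕP.≤-refl) (sym (SupportedBelow.fixes G (+ x) ℕP.≤-refl))
  ... | no x≢j = begin
    f (+ x)                   ≡⟨ cong f (reflect-fixes {i} {+ j} {+ x} (x≢1 ∘ flip trans ∣i∣≡1) x≢j) ⟨
    f (toB (i , j) (+ x))     ≡⟨ agree x 2≤x x≤n ⟩
    g (toD (i' , j) (+ x))    ≡⟨ cong g (toD≡toB {i'} {j} {+ x} (inj₂ 2≤x)) ⟩
    g (toB (i' , j) (+ x))    ≡⟨ cong g (reflect-fixes {i'} {+ j} {+ x} (x≢1 ∘ flip trans ∣i'∣≡1) x≢j) ⟩
    g (+ x)                   ∎
    where
    x≢1 : x ≢ 1
    x≢1 = 2≤⇒≢1 2≤x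

weight : Factor → ℤ
weight (i , j) = + j ℤ.- i ℤ.- + 2 ℤ.* χneg i

weight-unit : ∀ i j → ∣ i ∣ ≡ 1 → weight (i , j) ≡ + j ℤ.- + 1
weight-unit (+ 1)      j refl = ℤP.+-identityʳ _
weight-unit -[1+ 0 ] j refl = ℤP.+-assoc (+ j) (+ 1) -[1+ 1 ]

module _ {n : ℕ} {i i' : ℤ} {j : ℕ} {rs qs : List Factor}
         (v : ValidB n (i , j)) (v' : ValidD n (i' , j))
         (vs : All (ValidB n) rs) (rs<j : IndicesBelow j rs)
         (vs' : All (ValidD n) qs) (qs<j : IndicesBelow j qs)
         (agree : Agree n (prodB ((i , j) ∷ rs)) (prodD ((i' , j) ∷ qs))) where

  private
    module P = SupportedBelow (prodB-supportedBelow-1+n (v ∷ vs))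
    module Q = SupportedBelow (prodD-supportedBelow-1+n (v' ∷ vs'))

    P-tail : SupportedBelow j (prodB rs)
    P-tail = prodB-supportedBelow vs rs<j

    Q-tail : SupportedBelow j (prodD qs)
    Q-tail = prodD-supportedBelow vs' qs<j

    P-at-i : prodB ((i , j) ∷ rs) i ≡ + j
    P-at-i = trans (cong (prodB rs) (reflect-at-a {a = i})) (SupportedBelow.fixes P-tail (+ j) ℕP.≤-refl)

    Q-at-i' : prodD ((i' , j) ∷ qs) i' ≡ + j
    Q-at-i' = trans (cong (prodD qs) (toD-at-i v')) (SupportedBelow.fixes Q-tail (+ j) ℕP.≤-refl)

    agree-at : ∀ {y} → ValidB n (y , j) → 2 ≤ ∣ y ∣ → prodB ((i , j) ∷ rs) y ≡ prodD ((i' , j) ∷ qs) y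
    agree-at {y} w 2≤y =
      agree-signed P.odd Q.odd agree y 2≤y (ℕP.≤-trans (validB-∣i∣≤j w) (validB-j≤n w))

  lower-index-unique : 2 ≤ ∣ i ∣ ⊎ 2 ≤ ∣ i' ∣ → i ≡ i'
  lower-index-unique (inj₁ 2≤i)  =
    Q.injective (trans (sym (agree-at v 2≤i)) (trans P-at-i (sym Q-at-i')))
  lower-index-unique (inj₂ 2≤i') =
    P.injective (trans P-at-i (trans (sym Q-at-i') (sym (agree-at (validD⇒validB v') 2≤i'))))

  sorSum-step : (Agree n (prodB rs) (prodD qs) → sorSum rs ≡ sorSum qs) →
    sorSum ((i , j) ∷ rs) ≡ sorSum ((i' , j) ∷ qs)
  sorSum-step ih with unit-or-≥2 (validB-1≤∣i∣ v) | unit-or-≥2 (validB-1≤∣i∣ (validD⇒validB v'))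
  ... | inj₁ ∣i∣≡1 | inj₁ ∣i'∣≡1 =
    cong₂ ℤ._+_ (trans (weight-unit i j ∣i∣≡1) (sym (weight-unit i' j ∣i'∣≡1)))
      (ih (agree-peel-unit {f = prodB rs} {prodD qs} {i} {i'} ∣i∣≡1 ∣i'∣≡1 P-tail Q-tail agree))
  ... | inj₂ 2≤i | _ with lower-index-unique (inj₁ 2≤i)
  ...   | refl = cong (ℤ._+_ (weight (i , j)))
                   (ih (agree-peel {f = prodB rs} {prodD qs} v 2≤i (validD-2≤j v') P.odd Q.odd agree))
  sorSum-step ih | inj₁ _ | inj₂ 2≤i' with lower-index-unique (inj₂ 2≤i')
  ...   | refl = cong (ℤ._+_ (weight (i , j)))
                   (ih (agree-peel {f = prodB rs} {prodD qs} (validD⇒validB v') 2≤i' (validD-2≤j v')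
                         P.odd Q.odd agree))

sorSum-top-unit : ∀ {n i rs} → ValidB n (i , 1) → All (ValidB n) rs → IndicesBelow 1 rs →
  sorSum ((i , 1) ∷ rs) ≡ 0ℤ
sorSum-top-unit (inj₁ (1≤i , i<1 , _)) _ _ = contradiction 1≤i (ℕP.<⇒≱ i<1)
sorSum-top-unit (inj₂ (refl , _)) []       []          = refl
sorSum-top-unit (inj₂ (refl , _)) (w ∷ _) (j<1 ∷ _) = contradiction (validB-1≤j w) (ℕP.<⇒≱ j<1)

sorSum-unique : ∀ {n} rs qs → All (ValidB n) rs → Descending rs → All (ValidD n) qs → Descending qs →
  Agree n (prodB rs) (prodD qs) → sorSum rs ≡ sorSum qs
sorSum-unique [] [] _ _ _ _ _ = refl
sorSum-unique [] ((i' , j') ∷ qs) _ _ (v' ∷ vs') (qs<j' ∷ _) agree =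
  contradiction (sym (agree j' (validD-2≤j v') (validB-j≤n (validD⇒validB v'))))
    (toD-moves-top v' (prodD-supportedBelow vs' qs<j'))
sorSum-unique ((i , j) ∷ rs) [] (v ∷ vs) (rs<j ∷ _) _ _ agree with unit-or-≥2 (validB-1≤j v)
... | inj₁ refl = sorSum-top-unit v vs rs<j
... | inj₂ 2≤j  = contradiction (agree j 2≤j (validB-j≤n v)) (toB-moves-top v (prodB-supportedBelow vs rs<j))
sorSum-unique ((i , j) ∷ rs) ((i' , j') ∷ qs) (v ∷ vs) (rs<j ∷ rs↓) (v' ∷ vs') (qs<j' ∷ qs↓) agree
  with ℕP.<-cmp j j'
... | tri< j<j' _ _ = contradiction
  (trans (sym (agree j' (validD-2≤j v') (validB-j≤n (validD⇒validB v'))))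
         (SupportedBelow.fixes (prodB-supportedBelow (v ∷ vs) (IndicesBelow-∷ j<j' rs<j)) (+ j') ℕP.≤-refl))
  (toD-moves-top v' (prodD-supportedBelow vs' qs<j'))
... | tri> _ _ j'<j = contradiction
  (trans (agree j (ℕP.≤-trans (validD-2≤j v') (ℕP.<⇒≤ j'<j)) (validB-j≤n v))
         (SupportedBelow.fixes (prodD-supportedBelow (v' ∷ vs') (IndicesBelow-∷ j'<j qs<j')) (+ j) ℕP.≤-refl))
  (toB-moves-top v (prodB-supportedBelow vs rs<j))
... | tri≈ _ refl _ = sorSum-step v v' vs rs<j vs' qs<j' agree (sorSum-unique rs qs vs rs↓ vs' qs↓)

prod-∷ʳ : ∀ ts (t : ℤ → ℤ) x → prod (ts ∷ʳ t) x ≡ prod ts (t x)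
prod-∷ʳ []       t x = refl
prod-∷ʳ (s ∷ ts) t x = cong s (prod-∷ʳ ts t x)

prod-reverse : ∀ ts x → prod (reverse ts) x ≡ prodʳ ts x
prod-reverse []       x = refl
prod-reverse (t ∷ ts) x = begin
  prod (reverse (t ∷ ts)) x  ≡⟨ cong (λ us → prod us x) (ListP.unfold-reverse t ts) ⟩
  prod (reverse ts ∷ʳ t) x   ≡⟨ prod-∷ʳ (reverse ts) t x ⟩
  prod (reverse ts) (t x)    ≡⟨ prod-reverse ts (t x) ⟩
  prodʳ ts (t x)             ∎

prod-map : ∀ (h : Factor → ℤ → ℤ) fs x → prod (map h fs) x ≡ prodʳ (map h (reverse fs)) x
prod-map h fs x = begin
  prod (map h fs) x                     ≡⟨ cong (λ us → prod us x) (ListP.reverse-involutive (map h fs)) ⟨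
  prod (reverse (reverse (map h fs))) x ≡⟨ prod-reverse (reverse (map h fs)) x ⟩
  prodʳ (reverse (map h fs)) x          ≡⟨ cong (λ us → prodʳ us x) (ListP.reverse-map h fs) ⟨
  prodʳ (map h (reverse fs)) x          ∎

sorSum-++ : ∀ fs gs → sorSum (fs ++ gs) ≡ sorSum fs ℤ.+ sorSum gs
sorSum-++ []       gs = sym (ℤP.+-identityˡ (sorSum gs))
sorSum-++ (f ∷ fs) gs = begin
  weight f ℤ.+ sorSum (fs ++ gs)              ≡⟨ cong (ℤ._+_ (weight f)) (sorSum-++ fs gs) ⟩
  weight f ℤ.+ (sorSum fs ℤ.+ sorSum gs)      ≡⟨ ℤP.+-assoc (weight f) (sorSum fs) (sorSum gs) ⟨
  weight f ℤ.+ sorSum fs ℤ.+ sorSum gs        ∎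

sorSum-reverse : ∀ fs → sorSum (reverse fs) ≡ sorSum fs
sorSum-reverse []       = refl
sorSum-reverse (f ∷ fs) = begin
  sorSum (reverse (f ∷ fs))                 ≡⟨ cong sorSum (ListP.unfold-reverse f fs) ⟩
  sorSum (reverse fs ∷ʳ f)                  ≡⟨ sorSum-++ (reverse fs) (f ∷ []) ⟩
  sorSum (reverse fs) ℤ.+ (weight f ℤ.+ 0ℤ) ≡⟨ cong₂ ℤ._+_ (sorSum-reverse fs) (ℤP.+-identityʳ (weight f)) ⟩
  sorSum fs ℤ.+ weight f                    ≡⟨ ℤP.+-comm (sorSum fs) (weight f) ⟩
  weight f ℤ.+ sorSum fs                    ∎

All-reverse : ∀ {A : Set} {P : A → Set} {xs} → All P xs → All P (reverse xs)
All-reverse ps = All.tabulate (All.lookup ps ∘ AnyP.reverse⁻)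

AllPairs-reverse : ∀ {A : Set} {R : A → A → Set} {xs} → AllPairs R xs → AllPairs (flip R) (reverse xs)
AllPairs-reverse []                           = []
AllPairs-reverse {R = R} {x ∷ xs} (x~xs ∷ xs~) =
  subst (AllPairs (flip R)) (sym (ListP.unfold-reverse x xs))
    (AllPairsP.++⁺ (AllPairs-reverse xs~) ([] ∷ []) (All.map (_∷ []) (All-reverse x~xs)))

descending-reverse : ∀ {fs} → Linked _<_ (map proj₂ fs) → Descending (reverse fs)
descending-reverse = AllPairs-reverse ∘ AllPairsP.map⁻ ∘ LinkedP.Linked⇒AllPairs ℕP.<-trans

represents-at : ∀ {n} σ ts {x} → Represents n σ ts → 1 ≤ x → x ≤ n → σ (+ x) ≡ prod ts (+ x)
represents-at {n} _ _ {suc _} σ≡ts _ x≤n = AllP.applyUpTo⁻ id n (AllP.map⁻ σ≡ts) x≤n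

lemma4p3 : (n : ℕ) → 2 ≤ n → (σ : ℤ → ℤ) → InD n σ →
    (fs gs : List Factor) → BFactorization n σ fs → DFactorization n σ gs →
    sorSum fs ≡ sorSum gs
lemma4p3 n _ σ _ fs gs (vfs , fs↑ , σ≡fs) (vgs , gs↑ , σ≡gs) = begin
  sorSum fs            ≡⟨ sorSum-reverse fs ⟨
  sorSum (reverse fs)  ≡⟨ sorSum-unique (reverse fs) (reverse gs) (All-reverse vfs) (descending-reverse fs↑)
                                        (All-reverse vgs) (descending-reverse gs↑) agree ⟩
  sorSum (reverse gs)  ≡⟨ sorSum-reverse gs ⟩
  sorSum gs            ∎
  where
  agree : Agree n (prodB (reverse fs)) (prodD (reverse gs))
  agree x 2≤x x≤n = begin
    prodB (reverse fs) (+ x)  ≡⟨ prod-map toB fs (+ x) ⟨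
    prod (map toB fs) (+ x)   ≡⟨ represents-at σ (map toB fs) σ≡fs 1≤x x≤n ⟨
    σ (+ x)                   ≡⟨ represents-at σ (map toD gs) σ≡gs 1≤x x≤n ⟩
    prod (map toD gs) (+ x)   ≡⟨ prod-map toD gs (+ x) ⟩
    prodD (reverse gs) (+ x)  ∎
    where
    1≤x : 1 ≤ x
    1≤x = ℕP.<⇒≤ 2≤x
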